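{- Let $\mathbf{x}$ be a complementation-symmetric Rote sequence. Then $r_{\mathbf{x}}(n)=n+1$ for all $n\ge 0$.
   Context: A factor of a sequence is a finite contiguous block. For a finite word $u=u(1)\cdots u(m)$, its reversal is $u^R=u(m)\cdots u(1)$; $u$ and $v$ are reflectively equivalent if $v=u$ or $v=u^R$. The reflection complexity $r_{\mathbf{x}}(n)$ is the number of distinct length-$n$ factors of $\mathbf{x}$ up to reflective equivalence; $\rho_{\mathbf{x}}(n)$ is the number of distinct length-$n$ factors. A binary sequence $\mathbf{x}$ is a Rote sequence if $\rho_{\mathbf{x}}(n)=2n$ for all $n\ge1$. It is complementation-symmetric if whenever $w$ is a factor, so is $E(w)$, where $E$ is the morphism exchanging $0$ and $1$. -}

module Defs where

open import Data.Bool using (Bool; not)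
open import Data.Nat using (ℕ; zero; suc)
open import Data.List using (List; []; _∷_; length; map; reverse)
open import Data.List.Relation.Unary.All using (All)
open import Data.List.Relation.Unary.Any using (Any)
open import Data.List.Relation.Unary.AllPairs using (AllPairs)
open import Data.Product using (Σ; ∃; _×_)
open import Data.Sum using (_⊎_)
open import Relation.Nullary using (¬_)
open import Relation.Binary.PropositionalEquality using (_≡_)

Seq : Set
Seq = ℕ → Bool

Word : Set
Word = List Bool

window : Seq → ℕ → ℕ → Word
window x i zero    = []
window x i (suc n) = x i ∷ window x (suc i) n

IsFactor : Seq → Word → Set
IsFactor x w = ∃ λ i → window x i (length w) ≡ w

FactorOfLength : Seq → ℕ → Word → Set
FactorOfLength x n w = IsFactor x w × length w ≡ n

RefEq : Word → Word → Set
RefEq u v = v ≡ u ⊎ v ≡ reverse u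

-- NumClasses R P k : the words satisfying P fall into exactly k classes
-- modulo R, witnessed by a list of k representatives satisfying P,
-- pairwise non-R-related, such that every word satisfying P is R-related
-- to one of them.
NumClasses : (Word → Word → Set) → (Word → Set) → ℕ → Set
NumClasses R P k =
  Σ (List Word) λ L →
    length L ≡ k × All P L × AllPairs (λ u v → ¬ R u v) L
    × (∀ w → P w → Any (λ u → R u w) L)

FactorComplexity : Seq → ℕ → ℕ → Set
FactorComplexity x n k = NumClasses _≡_ (FactorOfLength x n) k

ReflectionComplexity : Seq → ℕ → ℕ → Set
ReflectionComplexity x n k = NumClasses RefEq (FactorOfLength x n) k

IsRote : Seq → Set
IsRote x = ∀ n → FactorComplexity x (suc n) (2 Data.Nat.* suc n)

ComplementationSymmetric : Seq → Set
ComplementationSymmetric x = ∀ w → IsFactor x w → IsFactor x (map not w)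

-- Complementation symmetry makes every factor recurrent and maps right special
-- factors to right special factors, so the Rote count ρ(n + 1) − ρ(n) = 2 leaves
-- exactly one pair s, E s of right special factors of each positive length.
-- With this the language is closed under reversal, by induction on the length: for
-- a factor a v b the only hard case is v bispecial, where v and its reversal are
-- right special, hence the reversal is v or E v; then following the occurrences
-- of v and E v (the only right special factors of their length) from an occurrence
-- of (not a) v up to a later occurrence of a v shows that the reversal of a v b
-- cannot be missing. Consequently the palindromic factors of length n ≥ 1 are
-- exactly some π and E π, and the other 2n − 2 factors pair up with their
-- reversals, which leaves 2 + (n − 1) = n + 1 reflection classes.
module Submission where

open import Defs
open import Data.Bool using (Bool; true; false; not; _xor_)
open import Data.Bool.Properties
  using (not-involutive; not-¬; ¬-not; not-distribʳ-xor; xor-assoc; xor-same; xor-identityʳ)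
  renaming (_≟_ to _≟ᵇ_; ≤-decTotalOrder to ≤ᵇ-decTotalOrder)
open import Data.Nat using (ℕ; zero; suc; _+_; _*_; _∸_; _≤_; _<_; z≤n; s≤s)
open import Data.Nat.Properties
open import Data.List using (List; []; _∷_; [_]; _++_; _∷ʳ_; length; map; reverse; applyUpTo; filter; initLast; _∷ʳ′_)
open import Data.List.Properties
open import Data.List.Membership.Propositional using (_∈_)
open import Data.List.Relation.Unary.All as All using (All; []; _∷_)
open import Data.List.Relation.Unary.Any as Any using (Any; here; there; _─_)
import Data.List.Relation.Unary.All.Properties as All
open import Data.List.Relation.Unary.AllPairs using (AllPairs; []; _∷_)
open import Data.List.Relation.Unary.Unique.Propositional using (Unique)
import Data.List.Relation.Unary.Unique.Propositional.Properties as Unique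
open import Data.List.Relation.Binary.Disjoint.Propositional using (Disjoint)
open import Data.List.Membership.Propositional.Properties
  using (∈-map⁺; ∈-map⁻; ∈-applyUpTo⁻; ∈-++⁺ˡ; ∈-++⁺ʳ; ∈-filter⁺)
open import Data.List.Relation.Binary.Lex.NonStrict using () renaming (≤-decTotalOrder to lex-decTotalOrder)
open import Data.List.Relation.Binary.Pointwise using (Pointwise-≡⇒≡)
open import Relation.Binary.Bundles using (DecTotalOrder)
open import Data.Empty using (⊥)
open import Data.Product using (Σ; ∃; _×_; _,_; proj₁; proj₂)
open import Data.Sum using (_⊎_; inj₁; inj₂; [_,_]′)
open import Function using (_∘_)
open import Relation.Nullary using (¬_; Dec; yes; no; does; contradiction)
open import Relation.Nullary.Decidable using (decidable-stable; map′; _×-dec_; _⊎-dec_; ¬?)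
open import Relation.Binary using (tri<; tri≈; tri>)
open import Relation.Binary.PropositionalEquality hiding ([_])

∈-─ : {A : Set} {xs : List A} {x y : A} (x∈xs : x ∈ xs) → y ∈ xs → y ≢ x → y ∈ (xs ─ x∈xs)
∈-─ (here refl) (here refl) y≢x = contradiction refl y≢x
∈-─ (here _)    (there y∈xs) _  = y∈xs
∈-─ (there _)   (here refl) _   = here refl
∈-─ (there x∈xs) (there y∈xs) y≢x = there (∈-─ x∈xs y∈xs y≢x)

unique⊆⇒length≤ : {A : Set} {xs ys : List A} → Unique xs → All (_∈ ys) xs → length xs ≤ length ys
unique⊆⇒length≤ [] [] = z≤n
unique⊆⇒length≤ {xs = x ∷ xs} {ys} (x∉xs ∷ xs!) (x∈ys ∷ xs⊆ys) = begin
  suc (length xs)           ≤⟨ s≤s (unique⊆⇒length≤ xs! (All.zipWith shrink (xs⊆ys , x∉xs))) ⟩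
  suc (length (ys ─ x∈ys))  ≡⟨ sym (length-removeAt′ ys _) ⟩
  length ys                 ∎
  where
  open ≤-Reasoning
  shrink : ∀ {y} → y ∈ ys × x ≢ y → y ∈ (ys ─ x∈ys)
  shrink (y∈ys , x≢y) = ∈-─ x∈ys y∈ys (x≢y ∘ sym)

zipWith-AllPairs : {A : Set} {P : A → Set} {R S : A → A → Set} → (∀ {a b} → P a → P b → R a b → S a b) →
                   ∀ {xs} → All P xs → AllPairs R xs → AllPairs S xs
zipWith-AllPairs f []         []         = []
zipWith-AllPairs f (pa ∷ pxs) (ra ∷ rxs) = All.zipWith (λ (pb , r) → f pa pb r) (pxs , ra) ∷ zipWith-AllPairs f pxs rxs

≢⇒≡-other : ∀ {a b c : Bool} → a ≢ b → c ≢ a → c ≡ b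
≢⇒≡-other a≢b c≢a = trans (¬-not c≢a) (sym (¬-not (a≢b ∘ sym)))

xor-cancelˡ : ∀ s b → s xor (s xor b) ≡ b
xor-cancelˡ s b = trans (sym (xor-assoc s s b)) (cong (_xor b) (xor-same s))

xor-move : ∀ s {a b} → s xor a ≡ b → a ≡ s xor b
xor-move s {a} eq = trans (sym (xor-cancelˡ s a)) (cong (s xor_) eq)

xor-swap : ∀ b c d → b xor (c xor d) ≡ c xor (b xor d)
xor-swap false c     d = refl
xor-swap true  false d = refl
xor-swap true  true  d = refl

xor-shuffle : ∀ a b c d → a xor (b xor (c xor (a xor d))) ≡ c xor (b xor d)
xor-shuffle false b c d = xor-swap b c d
xor-shuffle true  b c d = begin
  not (b xor (c xor not d))  ≡⟨ cong (λ e → not (b xor e)) (sym (not-distribʳ-xor c d)) ⟩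
  not (b xor not (c xor d))  ≡⟨ cong not (sym (not-distribʳ-xor b (c xor d))) ⟩
  not (not (b xor (c xor d))) ≡⟨ not-involutive _ ⟩
  b xor (c xor d)            ≡⟨ xor-swap b c d ⟩
  c xor (b xor d)            ∎
  where open ≡-Reasoning

xor-witness : ∀ b c → ∃ λ σ → b ≡ σ xor c
xor-witness b c = b xor c , sym (begin
  (b xor c) xor c  ≡⟨ xor-assoc b c c ⟩
  b xor (c xor c)  ≡⟨ cong (b xor_) (xor-same c) ⟩
  b xor false      ≡⟨ xor-identityʳ b ⟩
  b                ∎)
  where open ≡-Reasoning

∀-Bool? : {P : Bool → Set} → Dec (P false) → Dec (P true) → Dec (∀ b → P b)
∀-Bool? p₀? p₁? = map′ (λ (p₀ , p₁) → λ { false → p₀ ; true → p₁ }) (λ p → p false , p true)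
                        (p₀? ×-dec p₁?)

∃-Bool? : {P : Bool → Set} → Dec (P false) → Dec (P true) → Dec (∃ P)
∃-Bool? p₀? p₁? = map′ [ (false ,_) , (true ,_) ]′ (λ { (false , p) → inj₁ p ; (true , p) → inj₂ p })
                        (p₀? ⊎-dec p₁?)

_≟ʷ_ : (u w : Word) → Dec (u ≡ w)
_≟ʷ_ = ≡-dec _≟ᵇ_

Palindrome : Word → Set
Palindrome w = reverse w ≡ w

length-∷ʳ : ∀ (w : Word) b → length (w ∷ʳ b) ≡ suc (length w)
length-∷ʳ w b = trans (length-++ w) (+-comm (length w) 1)

reverse-∷ʳ : ∀ (w : Word) b → reverse (w ∷ʳ b) ≡ b ∷ reverse w
reverse-∷ʳ w b = reverse-++ w [ b ]

reverse-∷-∷ʳ : ∀ a (w : Word) b → reverse (a ∷ (w ∷ʳ b)) ≡ b ∷ (reverse w ∷ʳ a)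
reverse-∷-∷ʳ a w b = trans (unfold-reverse a (w ∷ʳ b)) (cong (_∷ʳ a) (reverse-++ w [ b ]))

∷ʳ-view : ∀ {n} (w : Word) → length w ≡ suc n → Σ Word λ u → Σ Bool λ b → w ≡ u ∷ʳ b × length u ≡ n
∷ʳ-view w |w| with initLast w
... | u ∷ʳ′ b = u , b , refl , suc-injective (trans (sym (length-∷ʳ u b)) |w|)

∷-∷ʳ-view : ∀ {n} (w : Word) → length w ≡ suc (suc n) →
            Σ Bool λ a → Σ Word λ u → Σ Bool λ b → w ≡ a ∷ (u ∷ʳ b) × length u ≡ n
∷-∷ʳ-view (a ∷ w) |w| with ∷ʳ-view w (suc-injective |w|)
... | u , b , refl , |u| = a , u , b , refl , |u|

-- E⟨ s ⟩ is E^s; E w is definitionally map not w, the complement used in Defs.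
E⟨_⟩ : Bool → Word → Word
E⟨ s ⟩ = map (s xor_)

E : Word → Word
E = E⟨ true ⟩

E⟨false⟩ : ∀ w → E⟨ false ⟩ w ≡ w
E⟨false⟩ = map-id

E⟨⟩-E⟨⟩ : ∀ s t w → E⟨ s ⟩ (E⟨ t ⟩ w) ≡ E⟨ s xor t ⟩ w
E⟨⟩-E⟨⟩ s t w = trans (sym (map-∘ w)) (map-cong (λ b → sym (xor-assoc s t b)) w)

E⟨⟩-involutive : ∀ s w → E⟨ s ⟩ (E⟨ s ⟩ w) ≡ w
E⟨⟩-involutive s w = trans (E⟨⟩-E⟨⟩ s s w) (trans (cong (λ r → E⟨ r ⟩ w) (xor-same s)) (E⟨false⟩ w))

E⟨⟩-injective : ∀ s {u w} → E⟨ s ⟩ u ≡ E⟨ s ⟩ w → u ≡ w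
E⟨⟩-injective s {u} {w} eq = begin
  u                   ≡⟨ sym (E⟨⟩-involutive s u) ⟩
  E⟨ s ⟩ (E⟨ s ⟩ u)   ≡⟨ cong E⟨ s ⟩ eq ⟩
  E⟨ s ⟩ (E⟨ s ⟩ w)   ≡⟨ E⟨⟩-involutive s w ⟩
  w                   ∎
  where open ≡-Reasoning

length-E⟨⟩ : ∀ s w → length (E⟨ s ⟩ w) ≡ length w
length-E⟨⟩ s = length-map (s xor_)

E⟨⟩-∷ʳ : ∀ s w b → E⟨ s ⟩ (w ∷ʳ b) ≡ E⟨ s ⟩ w ∷ʳ (s xor b)
E⟨⟩-∷ʳ s w b = map-++ (s xor_) w [ b ]

E⟨⟩-∷-∷ʳ : ∀ s a w b → E⟨ s ⟩ (a ∷ (w ∷ʳ b)) ≡ (s xor a) ∷ (E⟨ s ⟩ w ∷ʳ (s xor b))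
E⟨⟩-∷-∷ʳ s a w b = cong ((s xor a) ∷_) (E⟨⟩-∷ʳ s w b)

reverse-E⟨⟩ : ∀ s w → reverse (E⟨ s ⟩ w) ≡ E⟨ s ⟩ (reverse w)
reverse-E⟨⟩ s w = sym (reverse-map (s xor_) w)

E-≢ : ∀ {w} → w ≢ [] → E w ≢ w
E-≢ {[]}    w≢[] _  = w≢[] refl
E-≢ {b ∷ w} _    eq = not-¬ {b} refl (sym (∷-injectiveˡ eq))

∷-≢-E⟨⟩∷ : ∀ τ {a b w} → a ≢ b → w ≢ [] → a ∷ w ≢ E⟨ τ ⟩ (b ∷ w)
∷-≢-E⟨⟩∷ false a≢b _    eq = a≢b (∷-injectiveˡ eq)
∷-≢-E⟨⟩∷ true  _   w≢[] eq = E-≢ w≢[] (sym (∷-injectiveʳ eq))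

-- Positions past the end read as false.
at : Word → ℕ → Bool
at []      _       = false
at (b ∷ w) zero    = b
at (b ∷ w) (suc t) = at w t

at-E⟨⟩ : ∀ s w {t} → t < length w → at (E⟨ s ⟩ w) t ≡ s xor at w t
at-E⟨⟩ s (b ∷ w) {zero}  _         = refl
at-E⟨⟩ s (b ∷ w) {suc t} (s≤s t<w) = at-E⟨⟩ s w t<w

at-∷ʳ : ∀ w b {t} → t < length w → at (w ∷ʳ b) t ≡ at w t
at-∷ʳ (c ∷ w) b {zero}  _         = refl
at-∷ʳ (c ∷ w) b {suc t} (s≤s t<w) = at-∷ʳ w b t<w

at-∷ʳ-length : ∀ w b → at (w ∷ʳ b) (length w) ≡ b
at-∷ʳ-length []      b = refl
at-∷ʳ-length (c ∷ w) b = at-∷ʳ-length w b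

at-reverse : ∀ w {t s} → t + suc s ≡ length w → at (reverse w) t ≡ at w s
at-reverse [] {t} eq = contradiction eq (m<n⇒n≢0 (m<m+n t (s≤s z≤n)))
at-reverse (b ∷ w) {t} {zero} eq = begin
  at (reverse (b ∷ w)) t                    ≡⟨ cong (λ u → at u t) (unfold-reverse b w) ⟩
  at (reverse w ∷ʳ b) t                     ≡⟨ cong (at (reverse w ∷ʳ b)) t≡ ⟩
  at (reverse w ∷ʳ b) (length (reverse w))  ≡⟨ at-∷ʳ-length (reverse w) b ⟩
  b                                         ∎
  where
  open ≡-Reasoning
  t≡ : t ≡ length (reverse w)
  t≡ = trans (suc-injective (trans (+-comm 1 t) eq)) (sym (length-reverse w))
at-reverse (b ∷ w) {t} {suc s} eq = begin
  at (reverse (b ∷ w)) t  ≡⟨ cong (λ u → at u t) (unfold-reverse b w) ⟩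
  at (reverse w ∷ʳ b) t   ≡⟨ at-∷ʳ (reverse w) b (subst (t <_) (sym (length-reverse w)) t<w) ⟩
  at (reverse w) t        ≡⟨ at-reverse w eq′ ⟩
  at w s                  ∎
  where
  open ≡-Reasoning
  eq′ : t + suc s ≡ length w
  eq′ = suc-injective (trans (sym (+-suc t (suc s))) eq)
  t<w : t < length w
  t<w = subst (t <_) eq′ (m<m+n t (s≤s z≤n))

module Factors (x : Seq) where

  window-length : ∀ i n → length (window x i n) ≡ n
  window-length i zero    = refl
  window-length i (suc n) = cong suc (window-length (suc i) n)

  window-isFactor : ∀ i n → IsFactor x (window x i n)
  window-isFactor i n = i , cong (window x i) (window-length i n)

  window-∷ʳ : ∀ i n → window x i (suc n) ≡ window x i n ∷ʳ x (n + i)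
  window-∷ʳ i zero    = refl
  window-∷ʳ i (suc n) = cong (x i ∷_)
    (trans (window-∷ʳ (suc i) n) (cong (λ j → window x (suc i) n ∷ʳ x j) (+-suc n i)))

  window-∷ʳ-isFactor : ∀ i n → IsFactor x (window x i n ∷ʳ x (n + i))
  window-∷ʳ-isFactor i n = subst (IsFactor x) (window-∷ʳ i n) (window-isFactor i (suc n))

  at-window : ∀ i {n t} → t < n → at (window x i n) t ≡ x (t + i)
  at-window i {suc n} {zero}  _         = refl
  at-window i {suc n} {suc t} (s≤s t<n) = trans (at-window (suc i) t<n) (cong x (+-suc t i))

  window-++⁻ : ∀ u {w i} → window x i (length u + length w) ≡ u ++ w →
               window x i (length u) ≡ u × window x (length u + i) (length w) ≡ w
  window-++⁻ []      eq = refl , eq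
  window-++⁻ (b ∷ u) {w} {i} eq with ∷-injective eq
  ... | xi≡b , eq′ with window-++⁻ u eq′
  ... | pre , suf = cong₂ _∷_ xi≡b pre , trans (cong (λ j → window x j (length w)) (sym (+-suc (length u) i))) suf

  isFactor-++⁻ : ∀ u w → IsFactor x (u ++ w) → IsFactor x u × IsFactor x w
  isFactor-++⁻ u w (i , eq) with window-++⁻ u (trans (cong (window x i) (sym (length-++ u))) eq)
  ... | pre , suf = (i , pre) , (length u + i , suf)

  isFactor-∷ʳ⁻ : ∀ {w} b → IsFactor x (w ∷ʳ b) → IsFactor x w
  isFactor-∷ʳ⁻ {w} b = proj₁ ∘ isFactor-++⁻ w [ b ]

  isFactor-∷⁻ : ∀ b {w} → IsFactor x (b ∷ w) → IsFactor x w
  isFactor-∷⁻ b {w} = proj₂ ∘ isFactor-++⁻ [ b ] w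

  rightExtension : ∀ {w} → IsFactor x w → ∃ λ b → IsFactor x (w ∷ʳ b)
  rightExtension {w} (i , eq) = x (length w + i) ,
    subst (λ u → IsFactor x (u ∷ʳ x (length w + i))) eq (window-∷ʳ-isFactor i (length w))

  RightSpecial : Word → Set
  RightSpecial w = ∀ b → IsFactor x (w ∷ʳ b)

  LeftSpecial : Word → Set
  LeftSpecial w = ∀ b → IsFactor x (b ∷ w)

  rightSpecial-≢ : ∀ {w a b} → IsFactor x (w ∷ʳ a) → IsFactor x (w ∷ʳ b) → a ≢ b → RightSpecial w
  rightSpecial-≢ {w} {a} wa wb a≢b c with c ≟ᵇ a
  ... | yes refl = wa
  ... | no c≢a   = subst (λ d → IsFactor x (w ∷ʳ d)) (sym (≢⇒≡-other a≢b c≢a)) wb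

  leftSpecial-≢ : ∀ {w a b} → IsFactor x (a ∷ w) → IsFactor x (b ∷ w) → a ≢ b → LeftSpecial w
  leftSpecial-≢ {w} {a} aw bw a≢b c with c ≟ᵇ a
  ... | yes refl = aw
  ... | no c≢a   = subst (λ d → IsFactor x (d ∷ w)) (sym (≢⇒≡-other a≢b c≢a)) bw

  rightExtension-unique : ∀ {w a b} → ¬ RightSpecial w → IsFactor x (w ∷ʳ a) → IsFactor x (w ∷ʳ b) → a ≡ b
  rightExtension-unique {a = a} {b} ¬rs wa wb =
    decidable-stable (a ≟ᵇ b) (¬rs ∘ rightSpecial-≢ wa wb)

  leftExtension-unique : ∀ {w a b} → ¬ LeftSpecial w → IsFactor x (a ∷ w) → IsFactor x (b ∷ w) → a ≡ b
  leftExtension-unique {a = a} {b} ¬ls aw bw =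
    decidable-stable (a ≟ᵇ b) (¬ls ∘ leftSpecial-≢ aw bw)

  window-suffix : ∀ k {i j n} → window x i (k + n) ≡ window x j (k + n) → window x (k + i) n ≡ window x (k + j) n
  window-suffix zero    eq = eq
  window-suffix (suc k) {i} {j} {n} eq = subst₂ (λ p q → window x p n ≡ window x q n) (+-suc k i) (+-suc k j)
    (window-suffix k (∷-injectiveʳ eq))

module Complementation (x : Seq) (cs : ComplementationSymmetric x) where
  open Factors x

  isFactor-E⟨⟩ : ∀ s {w} → IsFactor x w → IsFactor x (E⟨ s ⟩ w)
  isFactor-E⟨⟩ false {w} = subst (IsFactor x) (sym (E⟨false⟩ w))
  isFactor-E⟨⟩ true  {w} = cs w

  rightSpecial-E⟨⟩ : ∀ s {w} → RightSpecial w → RightSpecial (E⟨ s ⟩ w)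
  rightSpecial-E⟨⟩ s {w} rs b = subst (IsFactor x) eq (isFactor-E⟨⟩ s (rs (s xor b)))
    where
    eq : E⟨ s ⟩ (w ∷ʳ (s xor b)) ≡ E⟨ s ⟩ w ∷ʳ b
    eq = trans (E⟨⟩-∷ʳ s w (s xor b)) (cong (E⟨ s ⟩ w ∷ʳ_) (xor-cancelˡ s b))

  -- An occurrence at 0 only is impossible: the complement occurs somewhere, and
  -- not at 0, so it has a left neighbour, whose complement precedes the word.
  occurs-at-suc : ∀ {u} → IsFactor x u → ∃ λ p → window x (suc p) (length u) ≡ u
  occurs-at-suc {[]}    _            = 0 , refl
  occurs-at-suc {b ∷ u} (suc i , eq) = i , eq
  occurs-at-suc {w@(b ∷ u)} (zero , eq) with cs w (zero , eq)
  ... | zero , eq′ = contradiction (trans (sym eq′) (trans (cong (window x 0) (length-E⟨⟩ true w)) eq)) (E-≢ λ ())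
  ... | suc j , eq′ with isFactor-E⟨⟩ true (j , cong (x j ∷_) eq′)
  ... | q , eq″ = q , subst (λ z → window x (suc q) (length z) ≡ z) (E⟨⟩-involutive true w) (∷-injectiveʳ eq″)

  leftExtension : ∀ {w} → IsFactor x w → ∃ λ b → IsFactor x (b ∷ w)
  leftExtension f with occurs-at-suc f
  ... | p , eq = x p , p , cong (x p ∷_) eq

  recurrence : ∀ {u} → IsFactor x u → ∀ N → ∃ λ k → window x (N + k) (length u) ≡ u
  recurrence f zero = f
  recurrence {u} f (suc N) with recurrence f N
  ... | k , eq with occurs-at-suc (window-isFactor 0 (N + k + length u))
  ... | q , eq′ = k + q , (begin
    window x (suc N + (k + q)) (length u)  ≡⟨ cong (λ i → window x i (length u)) position ⟩
    window x (N + k + suc q) (length u)    ≡⟨ window-suffix (N + k) prefix-recurs ⟩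
    window x (N + k + 0) (length u)        ≡⟨ cong (λ i → window x i (length u)) (+-identityʳ (N + k)) ⟩
    window x (N + k) (length u)            ≡⟨ eq ⟩
    u                                      ∎)
    where
    open ≡-Reasoning
    position : suc N + (k + q) ≡ N + k + suc q
    position = trans (cong suc (sym (+-assoc N k q))) (sym (+-suc (N + k) q))
    prefix-recurs : window x (suc q) (N + k + length u) ≡ window x 0 (N + k + length u)
    prefix-recurs = trans (cong (window x (suc q)) (sym (window-length 0 (N + k + length u)))) eq′

  window-step : ∀ {n p q} ε → window x p n ≡ E⟨ ε ⟩ (window x q n) → ¬ RightSpecial (window x q n) →
                window x (suc p) n ≡ E⟨ ε ⟩ (window x (suc q) n)
  window-step {n} {p} {q} ε eq ¬rs = ∷-injectiveʳ (begin
    window x p (suc n)                               ≡⟨ window-∷ʳ p n ⟩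
    window x p n ∷ʳ x (n + p)                        ≡⟨ cong₂ _∷ʳ_ eq next≡ ⟩
    E⟨ ε ⟩ (window x q n) ∷ʳ (ε xor x (n + q))       ≡⟨ sym (E⟨⟩-∷ʳ ε (window x q n) (x (n + q))) ⟩
    E⟨ ε ⟩ (window x q n ∷ʳ x (n + q))               ≡⟨ cong E⟨ ε ⟩ (sym (window-∷ʳ q n)) ⟩
    E⟨ ε ⟩ (window x q (suc n))                      ∎)
    where
    open ≡-Reasoning
    continuation : IsFactor x (window x q n ∷ʳ (ε xor x (n + p)))
    continuation = subst (IsFactor x)
      (trans (E⟨⟩-∷ʳ ε (window x p n) (x (n + p)))
             (cong (_∷ʳ _) (trans (cong E⟨ ε ⟩ eq) (E⟨⟩-involutive ε _))))
      (isFactor-E⟨⟩ ε (window-∷ʳ-isFactor p n))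
    next≡ : x (n + p) ≡ ε xor x (n + q)
    next≡ = xor-move ε (rightExtension-unique ¬rs continuation (window-∷ʳ-isFactor q n))

module RoteFactors (x : Seq) (rote : IsRote x) where
  open Factors x

  factors : ℕ → List Word
  factors m = proj₁ (rote m)

  length-factors : ∀ m → length (factors m) ≡ 2 * suc m
  length-factors m with rote m
  ... | _ , length≡ , _ = length≡

  factors-sound : ∀ m → All (FactorOfLength x (suc m)) (factors m)
  factors-sound m with rote m
  ... | _ , _ , sound , _ = sound

  factors-unique : ∀ m → Unique (factors m)
  factors-unique m with rote m
  ... | _ , _ , _ , unique , _ = unique

  factors-complete : ∀ m {w} → FactorOfLength x (suc m) w → w ∈ factors m
  factors-complete m {w} with rote m
  ... | _ , _ , _ , _ , complete = Any.map sym ∘ complete w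

  isFactor? : ∀ w → Dec (IsFactor x w)
  isFactor? []      = yes (0 , refl)
  isFactor? (b ∷ w) = map′ (λ b∷w∈ → proj₁ (All.lookup (factors-sound (length w)) b∷w∈))
                           (λ f → factors-complete (length w) (f , refl))
                           (Any.any? ((b ∷ w) ≟ʷ_) (factors (length w)))

  rightSpecial? : ∀ w → Dec (RightSpecial w)
  rightSpecial? w = ∀-Bool? (isFactor? (w ∷ʳ false)) (isFactor? (w ∷ʳ true))

  leftSpecial? : ∀ w → Dec (LeftSpecial w)
  leftSpecial? w = ∀-Bool? (isFactor? (false ∷ w)) (isFactor? (true ∷ w))

  nextLetter : Word → Bool
  nextLetter w = not (does (isFactor? (w ∷ʳ false)))

  nextLetter-isFactor : ∀ {w} → IsFactor x w → IsFactor x (w ∷ʳ nextLetter w)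
  nextLetter-isFactor {w} f with isFactor? (w ∷ʳ false) | rightExtension f
  ... | yes f₀ | _          = f₀
  ... | no ¬f₀ | false , f₀ = contradiction f₀ ¬f₀
  ... | no ¬f₀ | true  , f₁ = f₁

  extend : Word → Word
  extend w = w ∷ʳ nextLetter w

  extend-isFactor : ∀ {m w} → FactorOfLength x m w → FactorOfLength x (suc m) (extend w)
  extend-isFactor {w = w} (f , |w|) = nextLetter-isFactor f , trans (length-∷ʳ w _) (cong suc |w|)

  -- Without right special factors, every factor of length m + 2 is the extension
  -- of its prefix, so there would be no more of them than of length m + 1.
  rightSpecial-exists : ∀ m → ∃ λ s → length s ≡ suc m × RightSpecial s
  rightSpecial-exists m with Any.any? rightSpecial? (factors m)
  ... | yes some with All.lookupAny (factors-sound m) some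
  ...   | (_ , |s|) , rs = _ , |s| , rs
  rightSpecial-exists m | no none =
    contradiction (unique⊆⇒length≤ (factors-unique (suc m)) (All.tabulate extended)) too-many
    where
    extended : ∀ {w} → w ∈ factors (suc m) → w ∈ map extend (factors m)
    extended {w} w∈ with All.lookup (factors-sound (suc m)) w∈
    ... | fw , |w| with ∷ʳ-view w |w|
    ... | u , b , refl , |u| = subst (_∈ map extend (factors m)) (cong (u ∷ʳ_) next≡) (∈-map⁺ extend u∈)
      where
      u∈ : u ∈ factors m
      u∈ = factors-complete m (isFactor-∷ʳ⁻ b fw , |u|)
      next≡ : nextLetter u ≡ b
      next≡ = rightExtension-unique (λ rs → none (Any.map (λ eq → subst RightSpecial eq rs) u∈))
                (nextLetter-isFactor (isFactor-∷ʳ⁻ b fw)) fw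
    too-many : ¬ (length (factors (suc m)) ≤ length (map extend (factors m)))
    too-many le = <⇒≱ (*-monoʳ-< 2 (n<1+n (suc m)))
      (subst₂ _≤_ (length-factors (suc m)) (trans (length-map extend (factors m)) (length-factors m)) le)

  -- Each right special factor contributes, besides its chosen extension, a second one.
  rightSpecial-count : ∀ m {S} → Unique S → All (λ s → length s ≡ suc m × RightSpecial s) S → length S ≤ 2
  rightSpecial-count m {S} S! S-rs = +-cancelˡ-≤ (2 * suc m) (length S) 2 (begin
    2 * suc m + length S      ≡⟨ sym length-candidates ⟩
    length candidates         ≤⟨ unique⊆⇒length≤ unique included ⟩
    length (factors (suc m))  ≡⟨ length-factors (suc m) ⟩
    2 * suc (suc m)           ≡⟨ trans (*-suc 2 (suc m)) (+-comm 2 (2 * suc m)) ⟩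
    2 * suc m + 2             ∎)
    where
    open ≤-Reasoning
    branch : Word → Word
    branch s = s ∷ʳ not (nextLetter s)
    candidates : List Word
    candidates = map extend (factors m) ++ map branch S
    length-candidates : length candidates ≡ 2 * suc m + length S
    length-candidates = trans (length-++ (map extend (factors m)))
      (cong₂ _+_ (trans (length-map extend (factors m)) (length-factors m)) (length-map branch S))
    disjoint : Disjoint (map extend (factors m)) (map branch S)
    disjoint (v∈₁ , v∈₂) with ∈-map⁻ extend v∈₁ | ∈-map⁻ branch v∈₂
    ... | u , _ , refl | s , _ , eq with ∷ʳ-injective u s eq
    ... | refl , next≡ = not-¬ refl next≡
    unique : Unique candidates
    unique = Unique.++⁺ (Unique.map⁺ (∷ʳ-injectiveˡ _ _) (factors-unique m))
                        (Unique.map⁺ (∷ʳ-injectiveˡ _ _) S!) disjoint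
    branch-isFactor : ∀ {s} → length s ≡ suc m × RightSpecial s → FactorOfLength x (suc (suc m)) (branch s)
    branch-isFactor {s} (|s| , rs) = rs _ , trans (length-∷ʳ s _) (cong suc |s|)
    included : All (_∈ factors (suc m)) candidates
    included = All.++⁺
      (All.map⁺ (All.map (factors-complete (suc m) ∘ extend-isFactor) (factors-sound m)))
      (All.map⁺ (All.map (factors-complete (suc m) ∘ branch-isFactor) S-rs))

module RoteSymmetric (x : Seq) (rote : IsRote x) (cs : ComplementationSymmetric x) where
  open Factors x public
  open Complementation x cs public
  open RoteFactors x rote public

  rightSpecial-unique : ∀ {m s t} → length s ≡ suc m → length t ≡ suc m → RightSpecial s → RightSpecial t →
                        ∃ λ σ → t ≡ E⟨ σ ⟩ s
  rightSpecial-unique {m} {s} {t} |s| |t| rs rt =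
    decidable-stable (∃-Bool? (t ≟ʷ E⟨ false ⟩ s) (t ≟ʷ E⟨ true ⟩ s)) λ t≢ →
      three≰two (rightSpecial-count m (unique t≢) (
        (|s| , rs) ∷ (trans (length-E⟨⟩ true s) |s| , rightSpecial-E⟨⟩ true rs) ∷ (|t| , rt) ∷ []))
    where
    three≰two : ¬ (3 ≤ 2)
    three≰two (s≤s (s≤s ()))
    s≢[] : s ≢ []
    s≢[] refl = 1+n≢0 (sym |s|)
    unique : ¬ (∃ λ σ → t ≡ E⟨ σ ⟩ s) → Unique (s ∷ E s ∷ t ∷ [])
    unique t≢ = (E-≢ s≢[] ∘ sym ∷ (λ s≡t → t≢ (false , trans (sym s≡t) (sym (E⟨false⟩ s)))) ∷ [])
              ∷ ((λ Es≡t → t≢ (true , sym Es≡t)) ∷ []) ∷ [] ∷ []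

  rightSpecial-∷ : ∀ {m v} → length v ≡ suc m → RightSpecial v → ∃ λ c → RightSpecial (c ∷ v)
  rightSpecial-∷ {m} {v} |v| rv with rightSpecial-exists (suc m)
  ... | [] , () , _
  ... | c ∷ s , |c∷s| , rc∷s
    with rightSpecial-unique |v| (suc-injective |c∷s|) rv (λ b → isFactor-∷⁻ c (rc∷s b))
  ... | σ , s≡ = σ xor c ,
    subst (λ w → RightSpecial ((σ xor c) ∷ w)) Eσs≡v (rightSpecial-E⟨⟩ σ {c ∷ s} rc∷s)
    where
    Eσs≡v : E⟨ σ ⟩ s ≡ v
    Eσs≡v = trans (cong E⟨ σ ⟩ s≡) (E⟨⟩-involutive σ v)

  E-disjoint-bound : ∀ m {ys} → Unique ys → Disjoint ys (map E ys) → All (FactorOfLength x (suc m)) ys →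
                     length ys ≤ suc m
  E-disjoint-bound m {ys} ys! disjoint fys = *-cancelˡ-≤ 2 (begin
    2 * length ys            ≡⟨ cong (length ys +_) (trans (+-identityʳ _) (sym (length-map E ys))) ⟩
    length ys + length (map E ys) ≡⟨ sym (length-++ ys) ⟩
    length (ys ++ map E ys)  ≤⟨ unique⊆⇒length≤ unique included ⟩
    length (factors m)       ≡⟨ length-factors m ⟩
    2 * suc m                ∎)
    where
    open ≤-Reasoning
    unique : Unique (ys ++ map E ys)
    unique = Unique.++⁺ ys! (Unique.map⁺ (E⟨⟩-injective true) ys!) disjoint
    E-isFactor : ∀ {w} → FactorOfLength x (suc m) w → FactorOfLength x (suc m) (E w)
    E-isFactor {w} (f , |w|) = isFactor-E⟨⟩ true f , trans (length-E⟨⟩ true w) |w|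
    included : All (_∈ factors m) (ys ++ map E ys)
    included = All.++⁺ (All.map (factors-complete m) fys) (All.map⁺ (All.map (factors-complete m ∘ E-isFactor) fys))

module Bispecial (x : Seq) (rote : IsRote x) (cs : ComplementationSymmetric x)
                 {m : ℕ} (v : Word) (|v| : length v ≡ suc m) (σ : Bool) (v-reverse : reverse v ≡ E⟨ σ ⟩ v)
                 (v-rs : Factors.RightSpecial x v) where

  open RoteSymmetric x rote cs

  K : ℕ
  K = length v

  v≢[] : v ≢ []
  v≢[] refl = 1+n≢0 (sym |v|)

  Hit : ℕ → Set
  Hit i = ∃ λ τ → window x i K ≡ E⟨ τ ⟩ v

  hit? : ∀ i → Dec (Hit i)
  hit? i = ∃-Bool? (window x i K ≟ʷ E⟨ false ⟩ v) (window x i K ≟ʷ E⟨ true ⟩ v)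

  ¬hit⇒¬rightSpecial : ∀ {i} → ¬ Hit i → ¬ RightSpecial (window x i K)
  ¬hit⇒¬rightSpecial {i} ¬hit rs = ¬hit (rightSpecial-unique |v| (trans (window-length i K) |v|) v-rs rs)

  NoHitBetween : ℕ → ℕ → Set
  NoHitBetween h l = ∀ t → t < l → ¬ Hit (suc t + h)

  -- Inside a gap between consecutive hits no window is right special, so a
  -- coincidence f t₁ ≡ E⟨ ε ⟩ (f t₂) persists one step further; pushed up to the
  -- closing hit it produces a hit inside the gap. Hence the windows of a gap and
  -- their complements are distinct factors of length K, and gaps are shorter than K.
  module Gap {h l τ τ′} (hit-h : window x h K ≡ E⟨ τ ⟩ v) (hit-l : window x (suc l + h) K ≡ E⟨ τ′ ⟩ v)
             (gap : NoHitBetween h l) where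

    f : ℕ → Word
    f t = window x (t + h) K

    f≢[] : ∀ t → f t ≢ []
    f≢[] t eq = 1+n≢0 (trans (sym (trans (window-length (t + h) K) |v|)) (cong length eq))

    step : ∀ {t₁ t₂} ε → t₂ < l → f t₁ ≡ E⟨ ε ⟩ (f (suc t₂)) → f (suc t₁) ≡ E⟨ ε ⟩ (f (suc (suc t₂)))
    step {t₂ = t₂} ε t₂<l eq = window-step ε eq (¬hit⇒¬rightSpecial (gap t₂ t₂<l))

    distinct-shifted : ∀ d {t₁ t₂} ε → t₁ < t₂ → l ≡ d + t₂ → f (suc t₁) ≢ E⟨ ε ⟩ (f (suc t₂))
    distinct-shifted zero {t₁} ε t₁<l refl eq =
      gap t₁ t₁<l (ε xor τ′ , trans eq (trans (cong E⟨ ε ⟩ hit-l) (E⟨⟩-E⟨⟩ ε τ′ v)))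
    distinct-shifted (suc d) {t₁} {t₂} ε t₁<t₂ l≡ eq =
      distinct-shifted d ε (s≤s t₁<t₂) (trans l≡ (sym (+-suc d t₂))) (step ε t₂<l eq)
      where
      t₂<l : t₂ < l
      t₂<l = subst (t₂ <_) (sym l≡) (s≤s (m≤n+m t₂ d))

    distinct : ∀ {t₁ t₂} ε → t₁ < t₂ → t₂ ≤ l → f t₁ ≢ E⟨ ε ⟩ (f t₂)
    distinct {t₂ = suc t₂} ε t₁<t₂ t₂<l eq =
      distinct-shifted (l ∸ suc t₂) ε t₁<t₂ (sym (m∸n+n≡m t₂<l)) (step ε t₂<l eq)

    gap-bound : l < K
    gap-bound = subst (l <_) (sym |v|)
      (subst (_≤ suc m) (length-applyUpTo f (suc l)) (E-disjoint-bound m unique disjoint all-factors))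
      where
      unique : Unique (applyUpTo f (suc l))
      unique = Unique.applyUpTo⁺₁ f (suc l) λ i<j j<1+l eq →
        distinct false i<j (≤-pred j<1+l) (trans eq (sym (E⟨false⟩ _)))
      disjoint : Disjoint (applyUpTo f (suc l)) (map E (applyUpTo f (suc l)))
      disjoint (w∈ , w∈E) with ∈-applyUpTo⁻ f w∈ | ∈-map⁻ E w∈E
      ... | i , i<1+l , refl | u , u∈ , eq with ∈-applyUpTo⁻ f u∈
      ... | j , j<1+l , refl with <-cmp i j
      ... | tri< i<j _ _  = distinct true i<j (≤-pred j<1+l) eq
      ... | tri≈ _ refl _ = E-≢ (f≢[] i) (sym eq)
      ... | tri> _ _ j<i  = distinct true j<i (≤-pred i<1+l)
                              (trans (sym (E⟨⟩-involutive true (f j))) (cong E (sym eq)))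
      all-factors : All (FactorOfLength x (suc m)) (applyUpTo f (suc l))
      all-factors = All.applyUpTo⁺₂ f (suc l) λ t →
        window-isFactor (t + h) K , trans (window-length (t + h) K) |v|

    -- Both occurrences cover the positions l + h and K + h, which are mirror
    -- images of each other inside v.
    mirrored-bits : τ xor x (K + h) ≡ σ xor (τ′ xor x (l + h))
    mirrored-bits = begin
      τ xor x (K + h)                            ≡⟨ cong (τ xor_) (trans at-r (cong (τ′ xor_) mirror)) ⟩
      τ xor (τ′ xor (σ xor at v l))              ≡⟨ cong (λ b → τ xor (τ′ xor (σ xor b))) (xor-move τ (sym at-l)) ⟩
      τ xor (τ′ xor (σ xor (τ xor x (l + h))))   ≡⟨ xor-shuffle τ τ′ σ (x (l + h)) ⟩
      σ xor (τ′ xor x (l + h))                   ∎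
      where
      open ≡-Reasoning
      r : ℕ
      r = m ∸ l
      l+1+r≡K : l + suc r ≡ K
      l+1+r≡K = trans (+-suc l r) (trans (cong suc (m+[n∸m]≡n (≤-pred (subst (l <_) |v| gap-bound)))) (sym |v|))
      r<K : r < K
      r<K = subst (r <_) (sym |v|) (s≤s (m∸n≤m m l))
      position : K + h ≡ r + (suc l + h)
      position = sym (trans (sym (+-assoc r (suc l) h))
                   (cong (_+ h) (trans (+-comm r (suc l)) (trans (sym (+-suc l r)) l+1+r≡K))))
      at-l : x (l + h) ≡ τ xor at v l
      at-l = trans (sym (at-window h gap-bound)) (trans (cong (λ w → at w l) hit-h) (at-E⟨⟩ τ v gap-bound))
      at-r : x (K + h) ≡ τ′ xor at v r
      at-r = trans (cong x position) (trans (sym (at-window (suc l + h) r<K))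
               (trans (cong (λ w → at w r) hit-l) (at-E⟨⟩ τ′ v r<K)))
      mirror : at v r ≡ σ xor at v l
      mirror = trans (sym (at-reverse v l+1+r≡K)) (trans (cong (λ w → at w l) v-reverse) (at-E⟨⟩ σ v gap-bound))

  -- If not a · v · (σ xor a) were missing, the hits of v and E v would propagate
  -- the marking "preceded by not a up to complement" forever, contradicting the
  -- recurrence of a · v.
  module NoReturn (a : Bool) (missing : ¬ IsFactor x (not a ∷ (v ∷ʳ (σ xor a)))) where

    Marked : ℕ → Set
    Marked i = ∃ λ τ → window x i (suc K) ≡ E⟨ τ ⟩ (not a ∷ v)

    marked-next : ∀ {i l τ′} → Marked i → window x (suc l + suc i) K ≡ E⟨ τ′ ⟩ v → NoHitBetween (suc i) l →
                  Marked (l + suc i)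
    marked-next {i} {l} {τ′} (τ , mark) hit-l gap = τ′ , cong₂ _∷_ x≡ hit-l
      where
      open Gap {τ = τ} {τ′} (∷-injectiveʳ mark) hit-l gap using (mirrored-bits)
      extension : IsFactor x (not a ∷ (v ∷ʳ (τ xor x (K + suc i))))
      extension = subst (IsFactor x)
        (trans (E⟨⟩-∷ʳ τ (window x i (suc K)) (x (suc K + i)))
               (cong₂ _∷ʳ_ (trans (cong E⟨ τ ⟩ mark) (E⟨⟩-involutive τ _)) (cong (λ j → τ xor x j) (sym (+-suc K i)))))
        (isFactor-E⟨⟩ τ (window-∷ʳ-isFactor i (suc K)))
      x≡ : x (l + suc i) ≡ τ′ xor not a
      x≡ = xor-move τ′ (¬-not λ eq → missing
        (subst (λ c → IsFactor x (not a ∷ (v ∷ʳ c))) (trans mirrored-bits (cong (σ xor_) eq)) extension))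

    -- The last hit at a position ≤ n + 1 is at i + 1, and i is marked.
    Tracked : ℕ → Set
    Tracked n = ∃ λ i → Marked i × ∃ λ g → g + i ≡ n × NoHitBetween (suc i) g

    tracked : ∀ {p} → Marked p → ∀ k → Tracked (k + p)
    tracked mark zero = _ , mark , 0 , refl , λ _ ()
    tracked mark (suc k) with tracked mark k
    ... | i , mark-i , g , g+i≡ , gap with hit? (suc g + suc i)
    ... | yes (τ′ , hit) =
      g + suc i , marked-next {τ′ = τ′} mark-i hit gap , 0 , trans (+-suc g i) (cong suc g+i≡) , λ _ ()
    ... | no ¬hit       = i , mark-i , suc g , cong suc g+i≡ , gap′
      where
      gap′ : NoHitBetween (suc i) (suc g)
      gap′ t t<1+g with m<1+n⇒m<n∨m≡n t<1+g
      ... | inj₁ t<g  = gap t t<g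
      ... | inj₂ refl = ¬hit

    no-return : IsFactor x (a ∷ v) → IsFactor x (not a ∷ v) → ⊥
    no-return av (p , occ) with recurrence av p
    ... | k , occ′ with tracked (false , trans occ (sym (E⟨false⟩ (not a ∷ v)))) k
    ... | i , (τ , mark) , zero , i≡ , _ = ∷-≢-E⟨⟩∷ τ (not-¬ refl) v≢[] (begin
      a ∷ v                     ≡⟨ sym occ′ ⟩
      window x (p + k) (suc K)  ≡⟨ cong (λ j → window x j (suc K)) (trans (+-comm p k) (sym i≡)) ⟩
      window x i (suc K)        ≡⟨ mark ⟩
      E⟨ τ ⟩ (not a ∷ v)        ∎)
      where open ≡-Reasoning
    ... | i , _ , suc g , g+i≡ , gap = gap g (n<1+n g)
      (false , trans (cong (λ j → window x j K) position) (trans (∷-injectiveʳ occ′) (sym (E⟨false⟩ v))))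
      where
      position : suc g + suc i ≡ suc (p + k)
      position = trans (+-suc (suc g) i) (cong suc (trans g+i≡ (+-comm k p)))

  reverse-isFactor : ∀ {a b} → LeftSpecial v → IsFactor x (a ∷ (v ∷ʳ b)) → IsFactor x (b ∷ (reverse v ∷ʳ a))
  reverse-isFactor {a} {b} v-ls avb = subst (IsFactor x) word≡ (isFactor-E⟨⟩ σ mirrored)
    where
    word≡ : E⟨ σ ⟩ ((σ xor b) ∷ (v ∷ʳ (σ xor a))) ≡ b ∷ (reverse v ∷ʳ a)
    word≡ = trans (E⟨⟩-∷-∷ʳ σ (σ xor b) v (σ xor a))
                  (cong₂ _∷_ (xor-cancelˡ σ b) (cong₂ _∷ʳ_ (sym v-reverse) (xor-cancelˡ σ a)))
    mirrored : IsFactor x ((σ xor b) ∷ (v ∷ʳ (σ xor a)))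
    mirrored with σ xor b ≟ᵇ a
    ... | yes σb≡a = subst₂ (λ c d → IsFactor x (c ∷ (v ∷ʳ d))) (sym σb≡a) (xor-move σ σb≡a) avb
    ... | no σb≢a  = subst (λ c → IsFactor x (c ∷ (v ∷ʳ (σ xor a)))) (sym (¬-not σb≢a))
      (decidable-stable (isFactor? _) λ missing →
        NoReturn.no-return a missing (isFactor-∷ʳ⁻ {a ∷ v} b avb) (v-ls (not a)))

module Reversal (x : Seq) (rote : IsRote x) (cs : ComplementationSymmetric x) where
  open RoteSymmetric x rote cs

  ReverseClosed : ℕ → Set
  ReverseClosed n = ∀ w → length w ≡ n → IsFactor x w → IsFactor x (reverse w)

  module _ {n} (rev : ReverseClosed (suc (suc n))) where

    reverse-∷-isFactor : ∀ {c w} → length w ≡ suc n → IsFactor x (c ∷ w) → IsFactor x (reverse w ∷ʳ c)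
    reverse-∷-isFactor {c} {w} |w| f = subst (IsFactor x) (unfold-reverse c w) (rev (c ∷ w) (cong suc |w|) f)

    reverse-∷ʳ-isFactor : ∀ {c w} → length w ≡ suc n → IsFactor x (w ∷ʳ c) → IsFactor x (c ∷ reverse w)
    reverse-∷ʳ-isFactor {c} {w} |w| f =
      subst (IsFactor x) (reverse-∷ʳ w c) (rev (w ∷ʳ c) (trans (length-∷ʳ w c) (cong suc |w|)) f)

    reverse-step : ∀ {a v b} → length v ≡ suc n → IsFactor x (a ∷ (v ∷ʳ b)) → IsFactor x (b ∷ (reverse v ∷ʳ a))
    reverse-step {a} {v} {b} |v| avb = by-cases (rightSpecial? u) (leftSpecial? u)
      where
      u : Word
      u = reverse v
      |u| : length u ≡ suc n
      |u| = trans (length-reverse v) |v|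
      ua : IsFactor x (u ∷ʳ a)
      ua = reverse-∷-isFactor |v| (isFactor-∷ʳ⁻ {a ∷ v} b avb)
      bu : IsFactor x (b ∷ u)
      bu = reverse-∷ʳ-isFactor |v| (isFactor-∷⁻ a avb)
      v-rightSpecial : LeftSpecial u → RightSpecial v
      v-rightSpecial ls c = subst (λ w → IsFactor x (w ∷ʳ c)) (reverse-involutive v) (reverse-∷-isFactor |u| (ls c))
      v-leftSpecial : RightSpecial u → LeftSpecial v
      v-leftSpecial rs c = subst (λ w → IsFactor x (c ∷ w)) (reverse-involutive v) (reverse-∷ʳ-isFactor |u| (rs c))
      by-cases : Dec (RightSpecial u) → Dec (LeftSpecial u) → IsFactor x (b ∷ (u ∷ʳ a))
      by-cases (no ¬rs) _ with rightExtension bu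
      ... | c , buc =
        subst (λ d → IsFactor x (b ∷ (u ∷ʳ d))) (rightExtension-unique ¬rs (isFactor-∷⁻ b buc) ua) buc
      by-cases (yes _) (no ¬ls) with leftExtension ua
      ... | c , cua =
        subst (λ d → IsFactor x (d ∷ (u ∷ʳ a))) (leftExtension-unique ¬ls (isFactor-∷ʳ⁻ {c ∷ u} a cua) bu) cua
      by-cases (yes rs) (yes ls) with rightSpecial-unique |v| |u| (v-rightSpecial ls) rs
      ... | σ , u≡ = Bispecial.reverse-isFactor x rote cs v |v| σ u≡ (v-rightSpecial ls) (v-leftSpecial rs) avb

    reverse-closed-step : ReverseClosed (suc (suc (suc n)))
    reverse-closed-step w |w| f with ∷-∷ʳ-view w |w|
    ... | a , v , b , refl , |v| = subst (IsFactor x) (sym (reverse-∷-∷ʳ a v b)) (reverse-step |v| f)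

  reverse-pair : ∀ a b → IsFactor x (a ∷ b ∷ []) → IsFactor x (b ∷ a ∷ [])
  reverse-pair false false f = f
  reverse-pair false true  f = cs _ f
  reverse-pair true  false f = cs _ f
  reverse-pair true  true  f = f

  isFactor-reverse : ∀ n → ReverseClosed n
  isFactor-reverse zero             []           _ f = f
  isFactor-reverse (suc zero)       (_ ∷ [])     _ f = f
  isFactor-reverse (suc (suc zero)) (a ∷ b ∷ []) _ f = reverse-pair a b f
  isFactor-reverse (suc (suc (suc n))) = reverse-closed-step (isFactor-reverse (suc (suc n)))

  reverse-closed : ∀ {w} → IsFactor x w → IsFactor x (reverse w)
  reverse-closed {w} = isFactor-reverse (length w) w refl

module PalindromicFactors (x : Seq) (rote : IsRote x) (cs : ComplementationSymmetric x) where
  open RoteSymmetric x rote cs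
  open Reversal x rote cs using (reverse-closed)

  palindrome-extension : ∀ {n v} → length v ≡ suc n → IsFactor x v → Palindrome v →
                         ∃ λ c → IsFactor x (c ∷ (v ∷ʳ c))
  palindrome-extension {v = v} |v| fv v-pal with rightSpecial? v
  ... | yes rs = let (c , rcv) = rightSpecial-∷ |v| rs in c , rcv c
  ... | no ¬rs with rightExtension fv
  ...   | b , vb with leftExtension vb
  ...     | c , cvb = c , subst (λ d → IsFactor x (c ∷ (v ∷ʳ d))) (rightExtension-unique ¬rs vb vc) cvb
    where
    vc : IsFactor x (v ∷ʳ c)
    vc = subst (IsFactor x) (trans (unfold-reverse c v) (cong (_∷ʳ c) v-pal))
               (reverse-closed (isFactor-∷ʳ⁻ {c ∷ v} b cvb))

  palindrome-extension-unique : ∀ {n v a b} → length v ≡ suc n → Palindrome v →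
                                IsFactor x (a ∷ (v ∷ʳ a)) → IsFactor x (b ∷ (v ∷ʳ b)) → a ≡ b
  palindrome-extension-unique {v = v} {a} {b} |v| v-pal ava bvb with rightSpecial? v
  ... | no ¬rs = rightExtension-unique ¬rs (isFactor-∷⁻ a ava) (isFactor-∷⁻ b bvb)
  ... | yes rs with rightSpecial-∷ |v| rs
  ...   | c , rcv = trans (centre ava) (sym (centre bvb))
    where
    v≢[] : v ≢ []
    v≢[] refl = 1+n≢0 (sym |v|)
    -- Two different centres would make both c · v and d · v right special.
    centre : ∀ {d} → IsFactor x (d ∷ (v ∷ʳ d)) → d ≡ c
    centre {d} dvd = decidable-stable (d ≟ᵇ c) λ d≢c →
      let dvc = subst (IsFactor x) (trans (reverse-∷-∷ʳ c v d) (cong (λ w → d ∷ (w ∷ʳ c)) v-pal))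
                      (reverse-closed (rcv d))
          (σ , dv≡) = rightSpecial-unique (cong suc |v|) (cong suc |v|) rcv (rightSpecial-≢ {d ∷ v} dvd dvc d≢c)
      in ∷-≢-E⟨⟩∷ σ d≢c v≢[] dv≡

  record Palindromes (n : ℕ) : Set where
    field
      π            : Word
      length-π     : length π ≡ suc n
      π-isFactor   : IsFactor x π
      π-palindrome : Palindrome π
      classify     : ∀ {w} → length w ≡ suc n → IsFactor x w → Palindrome w → ∃ λ σ → w ≡ E⟨ σ ⟩ π

  palindromes : ∀ n → Palindromes n
  palindromes zero = record
    { π = [ x 0 ] ; length-π = refl ; π-isFactor = 0 , refl ; π-palindrome = refl ; classify = classify }
    where
    classify : ∀ {w} → length w ≡ 1 → IsFactor x w → Palindrome w → ∃ λ σ → w ≡ E⟨ σ ⟩ [ x 0 ]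
    classify {b ∷ []} _ _ _ = let (σ , b≡) = xor-witness b (x 0) in σ , cong [_] b≡
  palindromes (suc zero) with rightSpecial-exists 0
  ... | c ∷ [] , _ , rs = record
    { π = c ∷ c ∷ [] ; length-π = refl ; π-isFactor = rs c ; π-palindrome = refl ; classify = classify }
    where
    classify : ∀ {w} → length w ≡ 2 → IsFactor x w → Palindrome w → ∃ λ σ → w ≡ E⟨ σ ⟩ (c ∷ c ∷ [])
    classify {a ∷ b ∷ []} _ _ ba≡ab with ∷-injectiveˡ ba≡ab
    ... | refl = let (σ , a≡) = xor-witness a c in σ , cong₂ (λ p q → p ∷ q ∷ []) a≡ a≡
  palindromes (suc (suc n)) = grow (palindromes n)
    where
    grow : Palindromes n → Palindromes (suc (suc n))
    grow P = record
      { π            = c ∷ (π ∷ʳ c)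
      ; length-π     = cong suc (trans (length-∷ʳ π c) (cong suc length-π))
      ; π-isFactor   = proj₂ extension
      ; π-palindrome = trans (reverse-∷-∷ʳ c π c) (cong (λ w → c ∷ (w ∷ʳ c)) π-palindrome)
      ; classify     = classify′
      }
      where
      open Palindromes P
      extension : ∃ λ c → IsFactor x (c ∷ (π ∷ʳ c))
      extension = palindrome-extension length-π π-isFactor π-palindrome
      c : Bool
      c = proj₁ extension
      classify′ : ∀ {w} → length w ≡ suc (suc (suc n)) → IsFactor x w → Palindrome w →
                  ∃ λ σ → w ≡ E⟨ σ ⟩ (c ∷ (π ∷ʳ c))
      classify′ {w} |w| fw w-pal with ∷-∷ʳ-view w |w|
      ... | a , u , b , refl , |u| with ∷-injective (trans (sym (reverse-∷-∷ʳ a u b)) w-pal)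
      ... | refl , ua≡ub
        with classify |u| (isFactor-∷ʳ⁻ b (isFactor-∷⁻ a fw)) (∷ʳ-injectiveˡ (reverse u) u ua≡ub)
      ... | σ , u≡ = σ , (begin
        a ∷ (u ∷ʳ a)                         ≡⟨ cong₂ (λ d z → d ∷ (z ∷ʳ d)) a≡ u≡ ⟩
        (σ xor c) ∷ (E⟨ σ ⟩ π ∷ʳ (σ xor c))  ≡⟨ sym (E⟨⟩-∷-∷ʳ σ c π c) ⟩
        E⟨ σ ⟩ (c ∷ (π ∷ʳ c))                ∎)
        where
        open ≡-Reasoning
        σa-centre : IsFactor x ((σ xor a) ∷ (π ∷ʳ (σ xor a)))
        σa-centre = subst (IsFactor x)
          (trans (E⟨⟩-∷-∷ʳ σ a u a)
                 (cong (λ z → (σ xor a) ∷ (z ∷ʳ (σ xor a))) (trans (cong E⟨ σ ⟩ u≡) (E⟨⟩-involutive σ π))))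
          (isFactor-E⟨⟩ σ fw)
        a≡ : a ≡ σ xor c
        a≡ = xor-move σ (palindrome-extension-unique length-π π-palindrome σa-centre (proj₂ extension))

reflectionComplexity-zero : ∀ x → ReflectionComplexity x 0 1
reflectionComplexity-zero x = [] ∷ [] , refl , ((0 , refl) , refl) ∷ [] , [] ∷ [] , covered
  where
  covered : ∀ w → FactorOfLength x 0 w → Any (λ u → RefEq u w) ([] ∷ [])
  covered [] _ = here (inj₁ refl)

open DecTotalOrder (lex-decTotalOrder ≤ᵇ-decTotalOrder)
  using () renaming (_≤_ to _≤ˡ_; _≤?_ to _≤ˡ?_; total to ≤ˡ-total; antisym to ≤ˡ-antisym)

-- Representatives: the two palindromes, and each non-palindrome that is
-- lexicographically below its reversal.
module ReflectionClasses {P : Word → Set} (P-reverse : ∀ {w} → P w → P (reverse w))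
                         {p q : Word} (p≢q : p ≢ q) (Pp : P p) (Pq : P q)
                         (p-palindrome : Palindrome p) (q-palindrome : Palindrome q)
                         (palindrome-cases : ∀ {w} → P w → Palindrome w → w ≡ p ⊎ w ≡ q) where

  Canonical : Word → Set
  Canonical u = u ≤ˡ reverse u × ¬ Palindrome u

  canonical? : ∀ u → Dec (Canonical u)
  canonical? u = (u ≤ˡ? reverse u) ×-dec ¬? (reverse u ≟ʷ u)

  reverse-¬canonical : ∀ {u} → Canonical u → ¬ Canonical (reverse u)
  reverse-¬canonical {u} (u≤ , u≢) (ru≤ , _) =
    u≢ (sym (Pointwise-≡⇒≡ (≤ˡ-antisym u≤ (subst (reverse u ≤ˡ_) (reverse-involutive u) ru≤))))

  canonical-or-reverse : ∀ {u} → ¬ Palindrome u → Canonical u ⊎ Canonical (reverse u)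
  canonical-or-reverse {u} u≢ with ≤ˡ-total u (reverse u)
  ... | inj₁ u≤  = inj₁ (u≤ , u≢)
  ... | inj₂ ru≤ = inj₂ (subst (reverse u ≤ˡ_) (sym (reverse-involutive u)) ru≤ ,
                         λ rru≡ru → u≢ (sym (trans (sym (reverse-involutive u)) rru≡ru)))

  module Count {k} (xs : List Word) (|xs| : length xs ≡ 2 * k) (xs-P : All P xs) (xs! : Unique xs)
               (xs-complete : ∀ w → P w → Any (λ u → u ≡ w) xs) where

    ∈xs : ∀ {w} → P w → w ∈ xs
    ∈xs {w} Pw = Any.map sym (xs-complete w Pw)

    reps : List Word
    reps = filter canonical? xs

    reps-canonical : All Canonical reps
    reps-canonical = All.all-filter canonical? xs

    reps-P : All P reps
    reps-P = All.filter⁺ canonical? xs-P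

    reps! : Unique reps
    reps! = Unique.filter⁺ canonical? xs!

    classify : ∀ {w} → P w → (w ≡ p ⊎ w ≡ q) ⊎ (w ∈ reps ⊎ reverse w ∈ reps)
    classify {w} Pw with reverse w ≟ʷ w
    ... | yes w-pal = inj₁ (palindrome-cases Pw w-pal)
    ... | no ¬w-pal with canonical-or-reverse ¬w-pal
    ...   | inj₁ can = inj₂ (inj₁ (∈-filter⁺ canonical? (∈xs Pw) can))
    ...   | inj₂ can = inj₂ (inj₂ (∈-filter⁺ canonical? (∈xs (P-reverse Pw)) can))

    all-words : List Word
    all-words = p ∷ q ∷ reps ++ map reverse reps

    palindrome-∉ : ∀ {z} → Palindrome z → All (z ≢_) (reps ++ map reverse reps)
    palindrome-∉ {z} z-pal = All.++⁺
      (All.map (λ { (_ , ¬pal) refl → ¬pal z-pal }) reps-canonical)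
      (All.map⁺ (All.map (λ { {u} (_ , ¬pal) refl → ¬pal (sym (trans (sym (reverse-involutive u)) z-pal)) })
                         reps-canonical))

    all-words! : Unique all-words
    all-words! = (p≢q ∷ palindrome-∉ p-palindrome) ∷ palindrome-∉ q-palindrome
               ∷ Unique.++⁺ reps! (Unique.map⁺ reverse-injective reps!) disjoint
      where
      disjoint : Disjoint reps (map reverse reps)
      disjoint (u∈ , u∈rev) with ∈-map⁻ reverse u∈rev
      ... | w , w∈ , refl = reverse-¬canonical (All.lookup reps-canonical w∈) (All.lookup reps-canonical u∈)

    all-words⊆xs : All (_∈ xs) all-words
    all-words⊆xs = ∈xs Pp ∷ ∈xs Pq ∷
                   All.++⁺ (All.map ∈xs reps-P) (All.map⁺ (All.map (∈xs ∘ P-reverse) reps-P))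

    xs⊆all-words : All (_∈ all-words) xs
    xs⊆all-words = All.map (λ { {w} Pw → into (classify Pw) }) xs-P
      where
      into : ∀ {w} → (w ≡ p ⊎ w ≡ q) ⊎ (w ∈ reps ⊎ reverse w ∈ reps) → w ∈ all-words
      into (inj₁ (inj₁ refl)) = here refl
      into (inj₁ (inj₂ refl)) = there (here refl)
      into (inj₂ (inj₁ w∈))   = there (there (∈-++⁺ˡ w∈))
      into {w} (inj₂ (inj₂ rw∈)) =
        there (there (∈-++⁺ʳ reps (subst (_∈ map reverse reps) (reverse-involutive w) (∈-map⁺ reverse rw∈))))

    length-reps : suc (length reps) ≡ k
    length-reps = *-cancelˡ-≡ (suc (length reps)) k 2 (begin
      2 * suc r                    ≡⟨ cong suc (trans (+-suc r (r + 0)) (cong (suc ∘ (r +_)) (+-identityʳ r))) ⟩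
      suc (suc (r + r))            ≡⟨ cong (suc ∘ suc ∘ (r +_)) (sym (length-map reverse reps)) ⟩
      suc (suc (r + length (map reverse reps))) ≡⟨ cong (suc ∘ suc) (sym (length-++ reps)) ⟩
      length all-words             ≡⟨ ≤-antisym (unique⊆⇒length≤ all-words! all-words⊆xs)
                                                (unique⊆⇒length≤ xs! xs⊆all-words) ⟩
      length xs                    ≡⟨ |xs| ⟩
      2 * k                        ∎)
      where
      open ≡-Reasoning
      r = length reps

    apart : AllPairs (λ u v → ¬ RefEq u v) (p ∷ q ∷ reps)
    apart = ((λ { (inj₁ q≡p) → p≢q (sym q≡p) ; (inj₂ q≡rp) → p≢q (sym (trans q≡rp p-palindrome)) })
               ∷ palindrome-apart p-palindrome)
          ∷ palindrome-apart q-palindrome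
          ∷ zipWith-AllPairs reps-apart reps-canonical reps!
      where
      palindrome-apart : ∀ {z} → Palindrome z → All (λ u → ¬ RefEq z u) reps
      palindrome-apart {z} z-pal = All.map (λ { (_ , ¬pal) (inj₁ refl) → ¬pal z-pal
                                              ; (_ , ¬pal) (inj₂ refl) → ¬pal (cong reverse z-pal) })
                                           reps-canonical
      reps-apart : ∀ {u w} → Canonical u → Canonical w → u ≢ w → ¬ RefEq u w
      reps-apart _     _     u≢w (inj₁ w≡u)  = u≢w (sym w≡u)
      reps-apart can-u can-w _   (inj₂ w≡ru) = reverse-¬canonical can-u (subst Canonical w≡ru can-w)

    covered : ∀ w → P w → Any (λ u → RefEq u w) (p ∷ q ∷ reps)
    covered w Pw with classify Pw
    ... | inj₁ (inj₁ w≡p) = here (inj₁ w≡p)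
    ... | inj₁ (inj₂ w≡q) = there (here (inj₁ w≡q))
    ... | inj₂ (inj₁ w∈)  = there (there (Any.map inj₁ w∈))
    ... | inj₂ (inj₂ rw∈) =
      there (there (Any.map (λ rw≡u → inj₂ (trans (sym (reverse-involutive w)) (cong reverse rw≡u))) rw∈))

    classes : NumClasses RefEq P (suc k)
    classes = p ∷ q ∷ reps , cong suc length-reps , Pp ∷ Pq ∷ reps-P , apart , covered

  count : ∀ k → NumClasses _≡_ P (2 * k) → NumClasses RefEq P (suc k)
  count k (xs , |xs| , xs-P , xs! , xs-complete) = Count.classes xs |xs| xs-P xs! xs-complete

theorem6p11 : (x : Seq) → IsRote x → ComplementationSymmetric x →
    (n : ℕ) → ReflectionComplexity x n (suc n)
theorem6p11 x rote cs zero    = reflectionComplexity-zero x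
theorem6p11 x rote cs (suc m) =
  ReflectionClasses.count reverse-factor π≢Eπ (π-isFactor , length-π) Eπ-factor
    π-palindrome Eπ-palindrome palindrome-cases (suc m) (rote m)
  where
  open RoteSymmetric x rote cs using (isFactor-E⟨⟩)
  open Reversal x rote cs using (reverse-closed)
  open PalindromicFactors x rote cs using (module Palindromes; palindromes)
  open Palindromes (palindromes m)
  reverse-factor : ∀ {w} → FactorOfLength x (suc m) w → FactorOfLength x (suc m) (reverse w)
  reverse-factor {w} (f , |w|) = reverse-closed f , trans (length-reverse w) |w|
  π≢Eπ : π ≢ E π
  π≢Eπ = E-≢ (λ π≡[] → 1+n≢0 (trans (sym length-π) (cong length π≡[]))) ∘ sym
  Eπ-factor : FactorOfLength x (suc m) (E π)
  Eπ-factor = isFactor-E⟨⟩ true π-isFactor , trans (length-E⟨⟩ true π) length-π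
  Eπ-palindrome : Palindrome (E π)
  Eπ-palindrome = trans (reverse-E⟨⟩ true π) (cong E π-palindrome)
  palindrome-cases : ∀ {w} → FactorOfLength x (suc m) w → Palindrome w → w ≡ π ⊎ w ≡ E π
  palindrome-cases (f , |w|) w-pal with classify |w| f w-pal
  ... | false , w≡ = inj₁ (trans w≡ (E⟨false⟩ π))
  ... | true  , w≡ = inj₂ w≡
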